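{- Let $a,b$ be positive integers with $a\mid b$ and let $S$ be a gcd-closed set of positive integers satisfying the condition $\mathcal G$. Let $x_m\in S$ with $G_S(x_m)=\{x_{m_1},x_{m_2},x_{m_3}\}$, and define $x_{m_4}=(x_{m_1},x_{m_2},x_{m_3})$ and $x_{m_{ij}}=(x_{m_i},x_{m_j})$ for $1\le i<j\le 3$. Then: (i) The integer $x_m^a-x_{m_1}^a-x_{m_2}^a-x_{m_3}^a+x_{m_{12}}^a+x_{m_{13}}^a+x_{m_{23}}^a-x_{m_4}^a$ divides $x_m^b-x_{m_1}^b-x_{m_2}^b-x_{m_3}^b+x_{m_{12}}^b+x_{m_{13}}^b+x_{m_{23}}^b-x_{m_4}^b$. (ii) For any $x_t\in S$ with $x_t\mid x_m$, the number $$\frac{x_m^{b-a}-x_{m_1}^{b-a}-x_{m_2}^{b-a}-x_{m_3}^{b-a}+x_{m_{12}}^{b-a}+x_{m_{13}}^{b-a}+x_{m_{23}}^{b-a}-x_{m_4}^{b-a}}{x_t^a\left(x_m^{ -a}-x_{m_1}^{ -a}-x_{m_2}^{ -a}-x_{m_3}^{ -a}+x_{m_{12}}^{ -a}+x_{m_{13}}^{ -a}+x_{m_{23}}^{ -a}-x_{m_4}^{ -a}\right)}$$ is an integer.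
   Context: $(x,y)$, $[x,y]$ denote gcd and lcm. $S$ is gcd closed if the gcd of any two elements of $S$ lies in $S$. For $x,y\in S$ with $x<y$, $x$ is a greatest-type divisor of $y$ in $S$ if $x\mid y$ and the conditions $x\mid d\mid y$, $d\in S$ imply $d\in\{x,y\}$; $G_S(y)$ is the set of greatest-type divisors of $y$ in $S$. For $x\in S$ with $|G_S(x)|\ge2$, two distinct $y_1,y_2\in G_S(x)$ satisfy the condition $\mathcal G$ if $[y_1,y_2]=x$ and $(y_1,y_2)\in G_S(y_1)\cap G_S(y_2)$; $x$ satisfies $\mathcal G$ if any two distinct elements of $G_S(x)$ do; $S$ satisfies $\mathcal G$ if every $x\in S$ has $|G_S(x)|\le1$ or satisfies $\mathcal G$. -}

module Defs where

open import Data.Nat using (ℕ; zero; suc; _<_; _^_)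
import Data.Nat as ℕ
open import Data.Nat.Properties using (m^n≢0)
open import Data.Nat.Divisibility using (_∣_)
open import Data.Nat.GCD using (gcd)
open import Data.Nat.LCM using (lcm)
open import Data.Integer as ℤ using (ℤ; +_)
open import Data.Rational as ℚ using (ℚ; _/_)
open import Data.List using (List)
open import Data.List.Membership.Propositional using (_∈_)
open import Data.List.Relation.Unary.All using (All)
open import Data.Product using (_×_)
open import Data.Sum using (_⊎_)
open import Relation.Binary.PropositionalEquality using (_≡_; _≢_)

-- A finite set S = {x_1, ..., x_n} of positive integers is represented by a
-- list; "x ∈ S" is list membership.

AllPositive : List ℕ → Set
AllPositive S = All (λ x → 0 < x) S

GcdClosed : List ℕ → Set
GcdClosed S = ∀ {x y} → x ∈ S → y ∈ S → gcd x y ∈ S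

-- x is a greatest-type divisor of y in S, i.e. x ∈ G_S(y)
IsGTD : List ℕ → ℕ → ℕ → Set
IsGTD S x y =
  x ∈ S × y ∈ S × x < y × x ∣ y ×
  (∀ d → d ∈ S → x ∣ d → d ∣ y → d ≡ x ⊎ d ≡ y)

PairCondG : List ℕ → ℕ → ℕ → ℕ → Set
PairCondG S x y₁ y₂ =
  lcm y₁ y₂ ≡ x × IsGTD S (gcd y₁ y₂) y₁ × IsGTD S (gcd y₁ y₂) y₂

ElemCondG : List ℕ → ℕ → Set
ElemCondG S x =
  ∀ y₁ y₂ → IsGTD S y₁ x → IsGTD S y₂ x → y₁ ≢ y₂ → PairCondG S x y₁ y₂

AtMostOneGTD : List ℕ → ℕ → Set
AtMostOneGTD S x = ∀ y₁ y₂ → IsGTD S y₁ x → IsGTD S y₂ x → y₁ ≡ y₂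

SatisfiesG : List ℕ → Set
SatisfiesG S = ∀ x → x ∈ S → AtMostOneGTD S x ⊎ ElemCondG S x

GTDsAre : List ℕ → ℕ → ℕ → ℕ → ℕ → Set
GTDsAre S x y₁ y₂ y₃ =
  y₁ ≢ y₂ × y₁ ≢ y₃ × y₂ ≢ y₃ ×
  (∀ y → IsGTD S y x → y ≡ y₁ ⊎ y ≡ y₂ ⊎ y ≡ y₃) ×
  IsGTD S y₁ x × IsGTD S y₂ x × IsGTD S y₃ x

pw : ℕ → ℕ → ℤ
pw x e = + (x ^ e)

-- x^{-a} as a rational number (for x > 0; junk value 0 at x = 0)
invPow : ℕ → ℕ → ℚ
invPow zero    a = ℚ.0ℚ
invPow (suc n) a = (+ 1) / (suc n ^ a)
  where instance _ = m^n≢0 (suc n) a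

toℚ : ℤ → ℚ
toℚ z = z / 1

incExc : ℕ → ℕ → ℕ → ℕ → ℕ → ℤ
incExc x x₁ x₂ x₃ e =
  pw x e ℤ.- pw x₁ e ℤ.- pw x₂ e ℤ.- pw x₃ e
  ℤ.+ pw (gcd x₁ x₂) e ℤ.+ pw (gcd x₁ x₃) e ℤ.+ pw (gcd x₂ x₃) e
  ℤ.- pw (gcd (gcd x₁ x₂) x₃) e

incExcInv : ℕ → ℕ → ℕ → ℕ → ℕ → ℚ
incExcInv x x₁ x₂ x₃ a =
  invPow x a ℚ.- invPow x₁ a ℚ.- invPow x₂ a ℚ.- invPow x₃ a
  ℚ.+ invPow (gcd x₁ x₂) a ℚ.+ invPow (gcd x₁ x₃) a ℚ.+ invPow (gcd x₂ x₃) a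
  ℚ.- invPow (gcd (gcd x₁ x₂) x₃) a

-- Because S satisfies 𝒢, any two of x₁, x₂, x₃ have lcm xₘ.
-- Writing xₘ = yᵢ xᵢ, this forces the yᵢ to be pairwise coprime and xₘ = g y₁ y₂ y₃, xᵢ = xₘ / yᵢ,
-- (xᵢ, xⱼ) = g yₖ and (x₁, x₂, x₃) = g for some g. For a completely multiplicative f
-- the inclusion–exclusion sum of f over these eight numbers is then
-- f(g) (f(y₁) − 1) (f(y₂) − 1) (f(y₃) − 1). Taking f(x) = xᵉ and f(x) = x⁻ᵃ gives
--   xₘᵉ − x₁ᵉ − ⋯ = gᵉ ∏ (yᵢᵉ − 1)   and   xₘᵃ (xₘ⁻ᵃ − x₁⁻ᵃ − ⋯) = − ∏ (yᵢᵃ − 1),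
-- and both claims follow from yᵃ − 1 ∣ yᵏᵃ − 1.
module Submission where

open import Defs
open import Data.Nat using (ℕ; _<_; _∸_; _^_)
open import Data.Nat.Divisibility using (_∣_)
open import Data.Integer using (ℤ; +_)
import Data.Integer.Divisibility as ℤD
open import Data.List using (List)
open import Data.List.Membership.Propositional using (_∈_)
open import Data.Product using (_×_; ∃)
open import Relation.Binary.PropositionalEquality using (_≡_; _≢_)

open import Algebra.Bundles using (RawRing)
open import Data.Empty using (⊥-elim)
open import Data.Integer as ℤ using (-[1+_]; 0ℤ; 1ℤ)
import Data.Integer.Divisibility.Signed as ℤ∣
import Data.Integer.Properties as ℤP
import Data.Integer.Tactic.RingSolver as ℤ-Solver
import Data.List.Relation.Unary.All as All
open import Data.Maybe using (nothing)
import Data.Nat as ℕ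
open import Data.Nat using (NonZero; zero; suc)
import Data.Nat.Divisibility as ℕ∣
open import Data.Nat.Coprimality as Coprimality
  using (Coprime; 1-coprimeTo; gcd≡1⇒coprime; coprime⇒gcd≡1; coprime-divisor)
open import Data.Nat.GCD using (gcd; gcd-comm; c*gcd[m,n]≡gcd[cm,cn])
open import Data.Nat.LCM using (lcm; gcd*lcm; lcm-comm)
import Data.Nat.Properties as ℕP
import Data.Nat.Tactic.RingSolver as ℕ-Solver
open import Data.Product using (_,_; proj₁; proj₂)
import Data.Rational as ℚ
import Data.Rational.Properties as ℚP
open import Data.Sum using ([_,_]′; inj₁; inj₂)
open import Function using (_∘_)
open import Level using (0ℓ)
open import Relation.Binary.PropositionalEquality using (refl; sym; trans; cong; cong₂; subst; subst₂; module ≡-Reasoning)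
open import Tactic.RingSolver using (solve-∀)
import Tactic.RingSolver.Core.AlmostCommutativeRing as ACR

-- Cofactors of a least common multiple

nonZero-factors : ∀ {m} p {q} .{{_ : NonZero m}} → m ≡ p ℕ.* q → NonZero p × NonZero q
nonZero-factors p refl = ℕP.m*n≢0⇒m≢0 p , ℕP.m*n≢0⇒n≢0 p

lcm≡q*v⇒u≡gcd*q : ∀ {u v m q} .{{_ : NonZero v}} → lcm u v ≡ m → m ≡ q ℕ.* v → u ≡ gcd u v ℕ.* q
lcm≡q*v⇒u≡gcd*q {u} {v} {m} {q} lcm≡m m≡qv = ℕP.*-cancelʳ-≡ u (gcd u v ℕ.* q) v (begin
  u ℕ.* v               ≡⟨ gcd*lcm u v ⟨
  gcd u v ℕ.* lcm u v   ≡⟨ cong (gcd u v ℕ.*_) (trans lcm≡m m≡qv) ⟩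
  gcd u v ℕ.* (q ℕ.* v) ≡⟨ ℕP.*-assoc (gcd u v) q v ⟨
  gcd u v ℕ.* q ℕ.* v   ∎)
  where open ≡-Reasoning

gcd-cofactors-coprime : ∀ {u v p q} .{{_ : NonZero (gcd u v)}} →
                        u ≡ gcd u v ℕ.* p → v ≡ gcd u v ℕ.* q → Coprime p q
gcd-cofactors-coprime {u} {v} {p} {q} u≡ v≡ =
  gcd≡1⇒coprime (ℕP.*-cancelˡ-≡ (gcd p q) 1 (gcd u v) (begin
    gcd u v ℕ.* gcd p q                 ≡⟨ c*gcd[m,n]≡gcd[cm,cn] (gcd u v) p q ⟩
    gcd (gcd u v ℕ.* p) (gcd u v ℕ.* q) ≡⟨ cong₂ gcd u≡ v≡ ⟨
    gcd u v                             ≡⟨ ℕP.*-identityʳ (gcd u v) ⟨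
    gcd u v ℕ.* 1                       ∎))
  where open ≡-Reasoning

coprime-* : ∀ {m n o} → Coprime m n → Coprime m o → Coprime m (n ℕ.* o)
coprime-* m⊥n m⊥o (d∣m , d∣no) = m⊥o (d∣m , coprime-divisor d⊥n d∣no)
  where
  d⊥n : Coprime _ _
  d⊥n (c∣d , c∣n) = m⊥n (ℕ∣.∣-trans c∣d d∣m , c∣n)

gcd[gc,gab]≡g : ∀ g {a b c} → Coprime c a → Coprime c b → gcd (g ℕ.* c) (g ℕ.* a ℕ.* b) ≡ g
gcd[gc,gab]≡g g {a} {b} {c} c⊥a c⊥b = begin
  gcd (g ℕ.* c) (g ℕ.* a ℕ.* b)   ≡⟨ cong (gcd (g ℕ.* c)) (ℕP.*-assoc g a b) ⟩
  gcd (g ℕ.* c) (g ℕ.* (a ℕ.* b)) ≡⟨ c*gcd[m,n]≡gcd[cm,cn] g c (a ℕ.* b) ⟨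
  g ℕ.* gcd c (a ℕ.* b)           ≡⟨ cong (g ℕ.*_) (coprime⇒gcd≡1 (coprime-* c⊥a c⊥b)) ⟩
  g ℕ.* 1                         ≡⟨ ℕP.*-identityʳ g ⟩
  g                               ∎
  where open ≡-Reasoning

module _ (u v p q : ℕ) {m : ℕ} .{{_ : NonZero m}}
         (lcm≡m : lcm u v ≡ m) (m≡pu : m ≡ p ℕ.* u) (m≡qv : m ≡ q ℕ.* v) where

  private instance
    u≢0 : NonZero u
    u≢0 = proj₂ (nonZero-factors p m≡pu)
    v≢0 : NonZero v
    v≢0 = proj₂ (nonZero-factors q m≡qv)

  lcm-cofactorˡ : u ≡ gcd u v ℕ.* q
  lcm-cofactorˡ = lcm≡q*v⇒u≡gcd*q lcm≡m m≡qv

  lcm-cofactorʳ : v ≡ gcd u v ℕ.* p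
  lcm-cofactorʳ = trans (lcm≡q*v⇒u≡gcd*q (trans (lcm-comm v u) lcm≡m) m≡pu) (cong (ℕ._* p) (gcd-comm v u))

  lcm-cofactors-coprime : Coprime q p
  lcm-cofactors-coprime =
    gcd-cofactors-coprime {{proj₁ (nonZero-factors (gcd u v) lcm-cofactorˡ)}} lcm-cofactorˡ lcm-cofactorʳ

record Decomposition (xm x₁ x₂ x₃ y₁ y₂ y₃ : ℕ) : Set where
  field
    g              : ℕ
    xm≡            : xm ≡ g ℕ.* y₁ ℕ.* y₂ ℕ.* y₃
    x₁≡            : x₁ ≡ g ℕ.* y₂ ℕ.* y₃
    x₂≡            : x₂ ≡ g ℕ.* y₁ ℕ.* y₃
    x₃≡            : x₃ ≡ g ℕ.* y₁ ℕ.* y₂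
    gcd[x₁,x₂]≡    : gcd x₁ x₂ ≡ g ℕ.* y₃
    gcd[x₁,x₃]≡    : gcd x₁ x₃ ≡ g ℕ.* y₂
    gcd[x₂,x₃]≡    : gcd x₂ x₃ ≡ g ℕ.* y₁
    gcd[x₁,x₂,x₃]≡ : gcd (gcd x₁ x₂) x₃ ≡ g

module _ {xm x₁ x₂ x₃ y₁ y₂ y₃ : ℕ} .{{_ : NonZero xm}}
         (m₁ : xm ≡ y₁ ℕ.* x₁) (m₂ : xm ≡ y₂ ℕ.* x₂) (m₃ : xm ≡ y₃ ℕ.* x₃)
         (l₁₂ : lcm x₁ x₂ ≡ xm) (l₁₃ : lcm x₁ x₃ ≡ xm) (l₂₃ : lcm x₂ x₃ ≡ xm) where

  private instance
    y₁≢0 : NonZero y₁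
    y₁≢0 = proj₁ (nonZero-factors y₁ m₁)
    y₂≢0 : NonZero y₂
    y₂≢0 = proj₁ (nonZero-factors y₂ m₂)

  y₁∣gcd[x₂,x₃] : y₁ ∣ gcd x₂ x₃
  y₁∣gcd[x₂,x₃] = coprime-divisor (Coprimality.sym (lcm-cofactors-coprime x₁ x₂ y₁ y₂ l₁₂ m₁ m₂))
    (ℕ∣.divides (gcd x₁ x₃) (begin
      y₂ ℕ.* gcd x₂ x₃ ≡⟨ ℕP.*-comm y₂ (gcd x₂ x₃) ⟩
      gcd x₂ x₃ ℕ.* y₂ ≡⟨ lcm-cofactorʳ x₂ x₃ y₂ y₃ l₂₃ m₂ m₃ ⟨
      x₃               ≡⟨ lcm-cofactorʳ x₁ x₃ y₁ y₃ l₁₃ m₁ m₃ ⟩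
      gcd x₁ x₃ ℕ.* y₁ ∎))
    where open ≡-Reasoning

  decompose : Decomposition xm x₁ x₂ x₃ y₁ y₂ y₃
  decompose = record
    { g              = g
    ; xm≡            = xm≡
    ; x₁≡            = x₁≡
    ; x₂≡            = trans (lcm-cofactorˡ x₂ x₃ y₂ y₃ l₂₃ m₂ m₃) (cong (ℕ._* y₃) G₂₃≡)
    ; x₃≡            = x₃≡
    ; gcd[x₁,x₂]≡    = G₁₂≡
    ; gcd[x₁,x₃]≡    = ℕP.*-cancelʳ-≡ _ _ y₁
                         (trans (sym (lcm-cofactorʳ x₁ x₃ y₁ y₃ l₁₃ m₁ m₃)) (trans x₃≡ (swap g y₁ y₂)))
    ; gcd[x₂,x₃]≡    = G₂₃≡
    ; gcd[x₁,x₂,x₃]≡ = trans (cong₂ gcd G₁₂≡ x₃≡)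
                         (gcd[gc,gab]≡g g (lcm-cofactors-coprime x₁ x₃ y₁ y₃ l₁₃ m₁ m₃)
                                          (lcm-cofactors-coprime x₂ x₃ y₂ y₃ l₂₃ m₂ m₃))
    }
    where
    swap : ∀ a b c → a ℕ.* b ℕ.* c ≡ a ℕ.* c ℕ.* b
    swap = ℕ-Solver.solve-∀
    pull : ∀ g y₁ y₂ y₃ → g ℕ.* y₁ ℕ.* y₂ ℕ.* y₃ ≡ y₁ ℕ.* (g ℕ.* y₂ ℕ.* y₃)
    pull = ℕ-Solver.solve-∀
    g = _∣_.quotient y₁∣gcd[x₂,x₃]
    G₂₃≡ : gcd x₂ x₃ ≡ g ℕ.* y₁
    G₂₃≡ = _∣_.equality y₁∣gcd[x₂,x₃]
    x₃≡ : x₃ ≡ g ℕ.* y₁ ℕ.* y₂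
    x₃≡ = trans (lcm-cofactorʳ x₂ x₃ y₂ y₃ l₂₃ m₂ m₃) (cong (ℕ._* y₂) G₂₃≡)
    xm≡ : xm ≡ g ℕ.* y₁ ℕ.* y₂ ℕ.* y₃
    xm≡ = trans m₃ (trans (cong (y₃ ℕ.*_) x₃≡) (ℕP.*-comm y₃ _))
    x₁≡ : x₁ ≡ g ℕ.* y₂ ℕ.* y₃
    x₁≡ = ℕP.*-cancelˡ-≡ x₁ (g ℕ.* y₂ ℕ.* y₃) y₁ (trans (sym m₁) (trans xm≡ (pull g y₁ y₂ y₃)))
    G₁₂≡ : gcd x₁ x₂ ≡ g ℕ.* y₃
    G₁₂≡ = ℕP.*-cancelʳ-≡ _ _ y₂ (trans (sym (lcm-cofactorˡ x₁ x₂ y₁ y₂ l₁₂ m₁ m₂)) (trans x₁≡ (swap g y₂ y₃)))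

decomposition-g≢0 : ∀ {xm x₁ x₂ x₃ y₁ y₂ y₃} .{{_ : NonZero xm}} (D : Decomposition xm x₁ x₂ x₃ y₁ y₂ y₃) →
                    NonZero (Decomposition.g D)
decomposition-g≢0 {y₁ = y₁} {y₂} {y₃} D = proj₁ (nonZero-factors g (trans xm≡ (assoc g y₁ y₂ y₃)))
  where
  open Decomposition D using (g; xm≡)
  assoc : ∀ g y₁ y₂ y₃ → g ℕ.* y₁ ℕ.* y₂ ℕ.* y₃ ≡ g ℕ.* (y₁ ℕ.* y₂ ℕ.* y₃)
  assoc = ℕ-Solver.solve-∀

-- Inclusion–exclusion sums of multiplicative functions

-- incExc xm x₁ x₂ x₃ e and incExcInv xm x₁ x₂ x₃ a are, definitionally, incExcSum over
-- ℤ and ℚ of x ↦ xᵉ and x ↦ x⁻ᵃ.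
module InclusionExclusion {c ℓ} (R : RawRing c ℓ) where
  open RawRing R

  incExcSum : (ℕ → Carrier) → ℕ → ℕ → ℕ → ℕ → Carrier
  incExcSum f xm x₁ x₂ x₃ = f xm + - f x₁ + - f x₂ + - f x₃
    + f (gcd x₁ x₂) + f (gcd x₁ x₃) + f (gcd x₂ x₃) + - f (gcd (gcd x₁ x₂) x₃)

  incExcSum-decomposition :
    ∀ {xm x₁ x₂ x₃ y₁ y₂ y₃} (f : ℕ → Carrier) → (∀ m n → f (m ℕ.* n) ≡ f m * f n) →
    (D : Decomposition xm x₁ x₂ x₃ y₁ y₂ y₃) →
    let G = f (Decomposition.g D); Y₁ = f y₁; Y₂ = f y₂; Y₃ = f y₃ in
    incExcSum f xm x₁ x₂ x₃ ≡ G * Y₁ * Y₂ * Y₃ + - (G * Y₂ * Y₃) + - (G * Y₁ * Y₃) + - (G * Y₁ * Y₂)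
                                + G * Y₃ + G * Y₂ + G * Y₁ + - G
  incExcSum-decomposition {y₁ = y₁} {y₂} {y₃} f f-*
    record { g = g ; xm≡ = refl ; x₁≡ = refl ; x₂≡ = refl ; x₃≡ = refl
           ; gcd[x₁,x₂]≡ = g₁₂ ; gcd[x₁,x₃]≡ = g₁₃ ; gcd[x₂,x₃]≡ = g₂₃ ; gcd[x₁,x₂,x₃]≡ = g₁₂₃ }
    rewrite g₁₂₃ | g₁₂ | g₁₃ | g₂₃
          | f-* (g ℕ.* y₁ ℕ.* y₂) y₃ | f-* (g ℕ.* y₁) y₂ | f-* (g ℕ.* y₂) y₃ | f-* (g ℕ.* y₁) y₃
          | f-* g y₁ | f-* g y₂ | f-* g y₃ = refl

-- Sums with positive exponents

^-distribʳ-* : ∀ m n e → (m ℕ.* n) ^ e ≡ m ^ e ℕ.* n ^ e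
^-distribʳ-* m n zero    = refl
^-distribʳ-* m n (suc e) = trans (cong (m ℕ.* n ℕ.*_) (^-distribʳ-* m n e)) (interchange m n (m ^ e) (n ^ e))
  where
  interchange : ∀ a b c d → a ℕ.* b ℕ.* (c ℕ.* d) ≡ a ℕ.* c ℕ.* (b ℕ.* d)
  interchange = ℕ-Solver.solve-∀

pos-^ : ∀ m k → + (m ^ k) ≡ (+ m) ℤ.^ k
pos-^ m zero    = refl
pos-^ m (suc k) = trans (ℤP.pos-* m (m ^ k)) (cong (+ m ℤ.*_) (pos-^ m k))

pw-*-base : ∀ m n e → pw (m ℕ.* n) e ≡ pw m e ℤ.* pw n e
pw-*-base m n e = trans (cong +_ (^-distribʳ-* m n e)) (ℤP.pos-* (m ^ e) (n ^ e))

pw-+-exponent : ∀ m e f → pw m (e ℕ.+ f) ≡ pw m e ℤ.* pw m f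
pw-+-exponent m e f = trans (cong +_ (ℕP.^-distribˡ-+-* m e f)) (ℤP.pos-* (m ^ e) (m ^ f))

pw-*-exponent : ∀ m k e → pw m (k ℕ.* e) ≡ pw m e ℤ.^ k
pw-*-exponent m k e = begin
  + (m ^ (k ℕ.* e))  ≡⟨ cong (λ n → + (m ^ n)) (ℕP.*-comm k e) ⟩
  + (m ^ (e ℕ.* k))  ≡⟨ cong +_ (ℕP.^-*-assoc m e k) ⟨
  + ((m ^ e) ^ k)    ≡⟨ pos-^ (m ^ e) k ⟩
  pw m e ℤ.^ k       ∎
  where open ≡-Reasoning

*-pres-∣ : ∀ {i j k l} → i ℤ∣.∣ j → k ℤ∣.∣ l → i ℤ.* k ℤ∣.∣ j ℤ.* l
*-pres-∣ {j = j} {k = k} i∣j k∣l = ℤ∣.∣-trans (ℤ∣.*-monoˡ-∣ k i∣j) (ℤ∣.*-monoʳ-∣ j k∣l)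

i-1∣i^n-1 : ∀ i n → i ℤ.- 1ℤ ℤ∣.∣ i ℤ.^ n ℤ.- 1ℤ
i-1∣i^n-1 i zero    = ℤ∣.divides 0ℤ (sym (ℤP.*-zeroˡ (i ℤ.- 1ℤ)))
i-1∣i^n-1 i (suc n) = subst (i ℤ.- 1ℤ ℤ∣.∣_) (step i (i ℤ.^ n))
  (ℤ∣.∣m∣n⇒∣m+n (ℤ∣.∣n⇒∣m*n i (i-1∣i^n-1 i n)) ℤ∣.∣-refl)
  where
  step : ∀ i p → i ℤ.* (p ℤ.- 1ℤ) ℤ.+ (i ℤ.- 1ℤ) ≡ i ℤ.* p ℤ.- 1ℤ
  step = ℤ-Solver.solve-∀

cofactorProduct : ℕ → ℕ → ℕ → ℕ → ℤ
cofactorProduct y₁ y₂ y₃ e = (pw y₁ e ℤ.- 1ℤ) ℤ.* (pw y₂ e ℤ.- 1ℤ) ℤ.* (pw y₃ e ℤ.- 1ℤ)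

cofactorProduct-∣ : ∀ y₁ y₂ y₃ {a e} → a ∣ e → cofactorProduct y₁ y₂ y₃ a ℤ∣.∣ cofactorProduct y₁ y₂ y₃ e
cofactorProduct-∣ y₁ y₂ y₃ {a} (ℕ∣.divides k refl) =
  *-pres-∣ (*-pres-∣ (pred-∣ y₁) (pred-∣ y₂)) (pred-∣ y₃)
  where
  pred-∣ : ∀ y → pw y a ℤ.- 1ℤ ℤ∣.∣ pw y (k ℕ.* a) ℤ.- 1ℤ
  pred-∣ y = subst (λ t → pw y a ℤ.- 1ℤ ℤ∣.∣ t ℤ.- 1ℤ) (sym (pw-*-exponent y k a)) (i-1∣i^n-1 (pw y a) k)

cofactorProduct≢0 : ∀ {y₁ y₂ y₃ a} → 1 < y₁ → 1 < y₂ → 1 < y₃ → 0 < a → cofactorProduct y₁ y₂ y₃ a ≢ 0ℤ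
cofactorProduct≢0 {y₁} {y₂} {y₃} {a} 1<y₁ 1<y₂ 1<y₃ 0<a =
  [ [ pw-1≢0 1<y₁ , pw-1≢0 1<y₂ ]′ ∘ ℤP.i*j≡0⇒i≡0∨j≡0 _ , pw-1≢0 1<y₃ ]′ ∘ ℤP.i*j≡0⇒i≡0∨j≡0 _
  where
  pred≢0 : ∀ {n} → 1 < n → + n ℤ.- 1ℤ ≢ 0ℤ
  pred≢0 {suc (suc _)} _         ()
  pred≢0 {suc zero}    (ℕ.s≤s ()) _
  pw-1≢0 : ∀ {y} → 1 < y → pw y a ℤ.- 1ℤ ≢ 0ℤ
  pw-1≢0 {y} 1<y = pred≢0 (ℕP.^-monoʳ-< y 1<y 0<a)

incExc-factorisation : ∀ {xm x₁ x₂ x₃ y₁ y₂ y₃} (D : Decomposition xm x₁ x₂ x₃ y₁ y₂ y₃) e →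
  incExc xm x₁ x₂ x₃ e ≡ pw (Decomposition.g D) e ℤ.* cofactorProduct y₁ y₂ y₃ e
incExc-factorisation {y₁ = y₁} {y₂} {y₃} D e =
  trans (InclusionExclusion.incExcSum-decomposition ℤ.+-*-rawRing (λ x → pw x e) (λ m n → pw-*-base m n e) D)
        (factor (pw (Decomposition.g D) e) (pw y₁ e) (pw y₂ e) (pw y₃ e))
  where
  factor : ∀ G Y₁ Y₂ Y₃ →
    G ℤ.* Y₁ ℤ.* Y₂ ℤ.* Y₃ ℤ.- G ℤ.* Y₂ ℤ.* Y₃ ℤ.- G ℤ.* Y₁ ℤ.* Y₃ ℤ.- G ℤ.* Y₁ ℤ.* Y₂
      ℤ.+ G ℤ.* Y₃ ℤ.+ G ℤ.* Y₂ ℤ.+ G ℤ.* Y₁ ℤ.- G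
    ≡ G ℤ.* ((Y₁ ℤ.- 1ℤ) ℤ.* (Y₂ ℤ.- 1ℤ) ℤ.* (Y₃ ℤ.- 1ℤ))
  factor = ℤ-Solver.solve-∀

incExc-∣ : ∀ {xm x₁ x₂ x₃ y₁ y₂ y₃ a b} → Decomposition xm x₁ x₂ x₃ y₁ y₂ y₃ → a ℕ.≤ b → a ∣ b →
           incExc xm x₁ x₂ x₃ a ℤD.∣ incExc xm x₁ x₂ x₃ b
incExc-∣ {y₁ = y₁} {y₂} {y₃} {a} {b} D a≤b a∣b =
  ℤ∣.∣⇒∣ᵤ (subst₂ ℤ∣._∣_ (sym (incExc-factorisation D a)) (sym (incExc-factorisation D b))
    (*-pres-∣ gᵃ∣gᵇ (cofactorProduct-∣ y₁ y₂ y₃ a∣b)))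
  where
  open Decomposition D using (g)
  gᵃ∣gᵇ : pw g a ℤ∣.∣ pw g b
  gᵃ∣gᵇ = ℤ∣.divides (pw g (b ∸ a)) (begin
    pw g b                     ≡⟨ cong (pw g) (ℕP.m+[n∸m]≡n a≤b) ⟨
    pw g (a ℕ.+ (b ∸ a))       ≡⟨ pw-+-exponent g a (b ∸ a) ⟩
    pw g a ℤ.* pw g (b ∸ a)    ≡⟨ ℤP.*-comm (pw g a) (pw g (b ∸ a)) ⟩
    pw g (b ∸ a) ℤ.* pw g a    ∎)
    where open ≡-Reasoning

-- Sums with negative exponents

ℚ-ring : ACR.AlmostCommutativeRing 0ℓ 0ℓ
ℚ-ring = ACR.fromCommutativeRing ℚP.+-*-commutativeRing (λ _ → nothing)

toℚ≡mkℚ : ∀ i → toℚ i ≡ ℚ.mkℚ i 0 (Coprimality.sym (1-coprimeTo _))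
toℚ≡mkℚ (+ n)    = ℚP.normalize-coprime (Coprimality.sym (1-coprimeTo n))
toℚ≡mkℚ -[1+ n ] = cong ℚ.-_ (ℚP.normalize-coprime (Coprimality.sym (1-coprimeTo (suc n))))

toℚ-homo-* : ∀ i j → toℚ (i ℤ.* j) ≡ toℚ i ℚ.* toℚ j
toℚ-homo-* i j rewrite toℚ≡mkℚ i | toℚ≡mkℚ j = refl

toℚ-homo-+ : ∀ i j → toℚ (i ℤ.+ j) ≡ toℚ i ℚ.+ toℚ j
toℚ-homo-+ i j rewrite toℚ≡mkℚ i | toℚ≡mkℚ j =
  cong toℚ (cong₂ ℤ._+_ (sym (ℤP.*-identityʳ i)) (sym (ℤP.*-identityʳ j)))

toℚ-homo‿- : ∀ i → toℚ (ℤ.- i) ≡ ℚ.- toℚ i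
toℚ-homo‿- (+ zero)   = refl
toℚ-homo‿- ℤ.+[1+ n ] = refl
toℚ-homo‿- -[1+ n ]   rewrite toℚ≡mkℚ -[1+ n ] = toℚ≡mkℚ (+ suc n)

toℚ-injective : ∀ {i j} → toℚ i ≡ toℚ j → i ≡ j
toℚ-injective {i} {j} eq = begin
  i           ≡⟨ cong ℚ.↥_ (toℚ≡mkℚ i) ⟨
  ℚ.↥ toℚ i   ≡⟨ cong ℚ.↥_ eq ⟩
  ℚ.↥ toℚ j   ≡⟨ cong ℚ.↥_ (toℚ≡mkℚ j) ⟩
  j           ∎
  where open ≡-Reasoning

*≡toℚ-nonzero⇒≢0 : ∀ {r x i} → r ℚ.* x ≡ toℚ i → i ≢ 0ℤ → x ≢ ℚ.0ℚ
*≡toℚ-nonzero⇒≢0 {r} r*x≡i i≢0 refl = i≢0 (toℚ-injective (trans (sym r*x≡i) (ℚP.*-zeroʳ r)))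

toℚ-pw-*-base : ∀ m n e → toℚ (pw (m ℕ.* n) e) ≡ toℚ (pw m e) ℚ.* toℚ (pw n e)
toℚ-pw-*-base m n e = trans (cong toℚ (pw-*-base m n e)) (toℚ-homo-* (pw m e) (pw n e))

toℚ-cofactorProduct : ∀ y₁ y₂ y₃ e → let Y₁ = toℚ (pw y₁ e); Y₂ = toℚ (pw y₂ e); Y₃ = toℚ (pw y₃ e) in
  toℚ (cofactorProduct y₁ y₂ y₃ e) ≡ (Y₁ ℚ.- ℚ.1ℚ) ℚ.* (Y₂ ℚ.- ℚ.1ℚ) ℚ.* (Y₃ ℚ.- ℚ.1ℚ)
toℚ-cofactorProduct y₁ y₂ y₃ e =
  trans (toℚ-homo-* (P y₁ ℤ.* P y₂) (P y₃))
        (cong₂ ℚ._*_ (trans (toℚ-homo-* (P y₁) (P y₂)) (cong₂ ℚ._*_ (toℚ-pred y₁) (toℚ-pred y₂))) (toℚ-pred y₃))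
  where
  P : ℕ → ℤ
  P y = pw y e ℤ.- 1ℤ
  toℚ-pred : ∀ y → toℚ (P y) ≡ toℚ (pw y e) ℚ.- ℚ.1ℚ
  toℚ-pred y = toℚ-homo-+ (pw y e) (ℤ.- 1ℤ)

invPow-*-base : ∀ m n a → invPow (m ℕ.* n) a ≡ invPow m a ℚ.* invPow n a
invPow-*-base zero    n       a = sym (ℚP.*-zeroˡ (invPow n a))
invPow-*-base (suc m) zero    a rewrite ℕP.*-zeroʳ m = sym (ℚP.*-zeroʳ (invPow (suc m) a))
invPow-*-base (suc m) (suc n) a =
  trans (ℚP./-cong {+ 1} {(suc m ℕ.* suc n) ^ a} {+ 1} {M ℕ.* N}
                   {{ℕP.m^n≢0 (suc m ℕ.* suc n) a}} {{ℕP.m*n≢0 M N}} refl (^-distribʳ-* (suc m) (suc n) a))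
        (sym (1/p*1/q M N))
  where
  M = suc m ^ a
  N = suc n ^ a
  instance
    M≢0 = ℕP.m^n≢0 (suc m) a
    N≢0 = ℕP.m^n≢0 (suc n) a
  1/p*1/q : ∀ p q .{{_ : NonZero p}} .{{_ : NonZero q}} →
            (+ 1 ℚ./ p) ℚ.* (+ 1 ℚ./ q) ≡ (+ 1 ℚ./ (p ℕ.* q)) {{ℕP.m*n≢0 p q}}
  1/p*1/q (suc p) (suc q)
    rewrite ℚP.normalize-coprime {1} {p} (1-coprimeTo _) | ℚP.normalize-coprime {1} {q} (1-coprimeTo _) = refl

pw*invPow≡1 : ∀ x a .{{_ : NonZero x}} → toℚ (pw x a) ℚ.* invPow x a ≡ ℚ.1ℚ
pw*invPow≡1 (suc n) a = p*1/p (suc n ^ a) {{ℕP.m^n≢0 (suc n) a}}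
  where
  p*1/p : ∀ p .{{_ : NonZero p}} → toℚ (+ p) ℚ.* (+ 1 ℚ./ p) ≡ ℚ.1ℚ
  p*1/p (suc k) rewrite toℚ≡mkℚ (+ suc k) | ℚP.normalize-coprime {1} {k} (1-coprimeTo _) =
    ℚP.*-inverseʳ (ℚ.mkℚ (+ suc k) 0 (Coprimality.sym (1-coprimeTo _)))

incExcInv-factorisation : ∀ {xm x₁ x₂ x₃ y₁ y₂ y₃} (D : Decomposition xm x₁ x₂ x₃ y₁ y₂ y₃) a →
  incExcInv xm x₁ x₂ x₃ a
    ≡ invPow (Decomposition.g D) a ℚ.* ((invPow y₁ a ℚ.- ℚ.1ℚ) ℚ.* (invPow y₂ a ℚ.- ℚ.1ℚ) ℚ.* (invPow y₃ a ℚ.- ℚ.1ℚ))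
incExcInv-factorisation {y₁ = y₁} {y₂} {y₃} D a =
  trans (InclusionExclusion.incExcSum-decomposition ℚ.+-*-rawRing (λ x → invPow x a) (λ m n → invPow-*-base m n a) D)
        (factor (invPow (Decomposition.g D) a) (invPow y₁ a) (invPow y₂ a) (invPow y₃ a))
  where
  factor : ∀ G Y₁ Y₂ Y₃ →
    G ℚ.* Y₁ ℚ.* Y₂ ℚ.* Y₃ ℚ.- G ℚ.* Y₂ ℚ.* Y₃ ℚ.- G ℚ.* Y₁ ℚ.* Y₃ ℚ.- G ℚ.* Y₁ ℚ.* Y₂
      ℚ.+ G ℚ.* Y₃ ℚ.+ G ℚ.* Y₂ ℚ.+ G ℚ.* Y₁ ℚ.- G
    ≡ G ℚ.* ((Y₁ ℚ.- ℚ.1ℚ) ℚ.* (Y₂ ℚ.- ℚ.1ℚ) ℚ.* (Y₃ ℚ.- ℚ.1ℚ))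
  factor = solve-∀ ℚ-ring

cancel-inverses : ∀ G G⁻¹ Y₁ Y₁⁻¹ Y₂ Y₂⁻¹ Y₃ Y₃⁻¹ →
  G ℚ.* G⁻¹ ≡ ℚ.1ℚ → Y₁ ℚ.* Y₁⁻¹ ≡ ℚ.1ℚ → Y₂ ℚ.* Y₂⁻¹ ≡ ℚ.1ℚ → Y₃ ℚ.* Y₃⁻¹ ≡ ℚ.1ℚ →
  (G ℚ.* Y₁ ℚ.* Y₂ ℚ.* Y₃) ℚ.* (G⁻¹ ℚ.* ((Y₁⁻¹ ℚ.- ℚ.1ℚ) ℚ.* (Y₂⁻¹ ℚ.- ℚ.1ℚ) ℚ.* (Y₃⁻¹ ℚ.- ℚ.1ℚ)))
    ≡ ℚ.- ((Y₁ ℚ.- ℚ.1ℚ) ℚ.* (Y₂ ℚ.- ℚ.1ℚ) ℚ.* (Y₃ ℚ.- ℚ.1ℚ))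
cancel-inverses G G⁻¹ Y₁ Y₁⁻¹ Y₂ Y₂⁻¹ Y₃ Y₃⁻¹ GG⁻¹ Y₁Y₁⁻¹ Y₂Y₂⁻¹ Y₃Y₃⁻¹ =
  trans (regroup G G⁻¹ Y₁ Y₁⁻¹ Y₂ Y₂⁻¹ Y₃ Y₃⁻¹) (cong ℚ.-_ substitute)
  where
  regroup : ∀ G G⁻¹ Y₁ Y₁⁻¹ Y₂ Y₂⁻¹ Y₃ Y₃⁻¹ →
    (G ℚ.* Y₁ ℚ.* Y₂ ℚ.* Y₃) ℚ.* (G⁻¹ ℚ.* ((Y₁⁻¹ ℚ.- ℚ.1ℚ) ℚ.* (Y₂⁻¹ ℚ.- ℚ.1ℚ) ℚ.* (Y₃⁻¹ ℚ.- ℚ.1ℚ)))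
    ≡ ℚ.- ((G ℚ.* G⁻¹) ℚ.* ((Y₁ ℚ.- Y₁ ℚ.* Y₁⁻¹) ℚ.* (Y₂ ℚ.- Y₂ ℚ.* Y₂⁻¹) ℚ.* (Y₃ ℚ.- Y₃ ℚ.* Y₃⁻¹)))
  regroup = solve-∀ ℚ-ring
  substitute : (G ℚ.* G⁻¹) ℚ.* ((Y₁ ℚ.- Y₁ ℚ.* Y₁⁻¹) ℚ.* (Y₂ ℚ.- Y₂ ℚ.* Y₂⁻¹) ℚ.* (Y₃ ℚ.- Y₃ ℚ.* Y₃⁻¹))
               ≡ (Y₁ ℚ.- ℚ.1ℚ) ℚ.* (Y₂ ℚ.- ℚ.1ℚ) ℚ.* (Y₃ ℚ.- ℚ.1ℚ)
  substitute rewrite GG⁻¹ | Y₁Y₁⁻¹ | Y₂Y₂⁻¹ | Y₃Y₃⁻¹ = ℚP.*-identityˡ _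

pw*incExcInv : ∀ {xm x₁ x₂ x₃ y₁ y₂ y₃} (D : Decomposition xm x₁ x₂ x₃ y₁ y₂ y₃) a →
  .{{_ : NonZero (Decomposition.g D)}} .{{_ : NonZero y₁}} .{{_ : NonZero y₂}} .{{_ : NonZero y₃}} →
  toℚ (pw xm a) ℚ.* incExcInv xm x₁ x₂ x₃ a ≡ toℚ (ℤ.- cofactorProduct y₁ y₂ y₃ a)
pw*incExcInv {xm} {x₁} {x₂} {x₃} {y₁} {y₂} {y₃} D a = begin
  toℚ (pw xm a) ℚ.* incExcInv xm x₁ x₂ x₃ a
    ≡⟨ cong₂ ℚ._*_ xmᵃ≡ (incExcInv-factorisation D a) ⟩
  (G ℚ.* Y₁ ℚ.* Y₂ ℚ.* Y₃) ℚ.* (invPow g a ℚ.* ((invPow y₁ a ℚ.- ℚ.1ℚ) ℚ.* (invPow y₂ a ℚ.- ℚ.1ℚ) ℚ.* (invPow y₃ a ℚ.- ℚ.1ℚ)))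
    ≡⟨ cancel-inverses G _ Y₁ _ Y₂ _ Y₃ _ (pw*invPow≡1 g a) (pw*invPow≡1 y₁ a) (pw*invPow≡1 y₂ a) (pw*invPow≡1 y₃ a) ⟩
  ℚ.- ((Y₁ ℚ.- ℚ.1ℚ) ℚ.* (Y₂ ℚ.- ℚ.1ℚ) ℚ.* (Y₃ ℚ.- ℚ.1ℚ))
    ≡⟨ cong ℚ.-_ (toℚ-cofactorProduct y₁ y₂ y₃ a) ⟨
  ℚ.- toℚ (cofactorProduct y₁ y₂ y₃ a)
    ≡⟨ toℚ-homo‿- (cofactorProduct y₁ y₂ y₃ a) ⟨
  toℚ (ℤ.- cofactorProduct y₁ y₂ y₃ a) ∎
  where
  open ≡-Reasoning
  open Decomposition D using (g; xm≡)
  G  = toℚ (pw g a)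
  Y₁ = toℚ (pw y₁ a)
  Y₂ = toℚ (pw y₂ a)
  Y₃ = toℚ (pw y₃ a)
  xmᵃ≡ : toℚ (pw xm a) ≡ G ℚ.* Y₁ ℚ.* Y₂ ℚ.* Y₃
  xmᵃ≡ = begin
    toℚ (pw xm a)                                ≡⟨ cong (λ x → toℚ (pw x a)) xm≡ ⟩
    toℚ (pw (g ℕ.* y₁ ℕ.* y₂ ℕ.* y₃) a)          ≡⟨ toℚ-pw-*-base (g ℕ.* y₁ ℕ.* y₂) y₃ a ⟩
    toℚ (pw (g ℕ.* y₁ ℕ.* y₂) a) ℚ.* Y₃          ≡⟨ cong (ℚ._* Y₃) (toℚ-pw-*-base (g ℕ.* y₁) y₂ a) ⟩
    toℚ (pw (g ℕ.* y₁) a) ℚ.* Y₂ ℚ.* Y₃          ≡⟨ cong (λ t → t ℚ.* Y₂ ℚ.* Y₃) (toℚ-pw-*-base g y₁ a) ⟩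
    G ℚ.* Y₁ ℚ.* Y₂ ℚ.* Y₃                       ∎

incExcInv-quotient : ∀ {xm x₁ x₂ x₃ y₁ y₂ y₃ a e xt} (D : Decomposition xm x₁ x₂ x₃ y₁ y₂ y₃) →
  .{{_ : NonZero xm}} → 1 < y₁ → 1 < y₂ → 1 < y₃ → 0 < a → a ∣ e → xt ∣ xm →
  let Δ = toℚ (+ (xt ^ a)) ℚ.* incExcInv xm x₁ x₂ x₃ a in
  Δ ≢ ℚ.0ℚ × ∃ λ (k : ℤ) → toℚ (incExc xm x₁ x₂ x₃ e) ≡ toℚ k ℚ.* Δ
incExcInv-quotient {xm} {x₁} {x₂} {x₃} {y₁} {y₂} {y₃} {a} {e} {xt} D 1<y₁ 1<y₂ 1<y₃ 0<a a∣e (ℕ∣.divides r xm≡r*xt) =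
  Δ≢0 , (ℤ.- (pw g e ℤ.* q) ℤ.* pw r a , incExcᵉ≡)
  where
  open ≡-Reasoning
  open Decomposition D using (g; xm≡)
  instance
    g≢0 = decomposition-g≢0 D
    y₁≢0 = ℕ.>-nonZero (ℕP.<⇒≤ 1<y₁)
    y₂≢0 = ℕ.>-nonZero (ℕP.<⇒≤ 1<y₂)
    y₃≢0 = ℕ.>-nonZero (ℕP.<⇒≤ 1<y₃)
  C = cofactorProduct y₁ y₂ y₃ a
  I = incExcInv xm x₁ x₂ x₃ a
  R = toℚ (pw r a)
  Δ = toℚ (pw xt a) ℚ.* I
  R*Δ≡ : R ℚ.* Δ ≡ toℚ (ℤ.- C)
  R*Δ≡ = begin
    R ℚ.* (toℚ (pw xt a) ℚ.* I)   ≡⟨ ℚP.*-assoc R (toℚ (pw xt a)) I ⟨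
    R ℚ.* toℚ (pw xt a) ℚ.* I     ≡⟨ cong (ℚ._* I) (toℚ-pw-*-base r xt a) ⟨
    toℚ (pw (r ℕ.* xt) a) ℚ.* I   ≡⟨ cong (λ x → toℚ (pw x a) ℚ.* I) xm≡r*xt ⟨
    toℚ (pw xm a) ℚ.* I           ≡⟨ pw*incExcInv D a ⟩
    toℚ (ℤ.- C)                   ∎
  Δ≢0 : Δ ≢ ℚ.0ℚ
  Δ≢0 = *≡toℚ-nonzero⇒≢0 {R} R*Δ≡ (cofactorProduct≢0 1<y₁ 1<y₂ 1<y₃ 0<a ∘ ℤP.neg-injective)
  C∣Cᵉ = cofactorProduct-∣ y₁ y₂ y₃ a∣e
  q = ℤ∣._∣_.quotient C∣Cᵉ
  signs : ∀ G q C → G ℤ.* (q ℤ.* C) ≡ ℤ.- (G ℤ.* q) ℤ.* ℤ.- C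
  signs = ℤ-Solver.solve-∀
  incExcᵉ≡ : toℚ (incExc xm x₁ x₂ x₃ e) ≡ toℚ (ℤ.- (pw g e ℤ.* q) ℤ.* pw r a) ℚ.* Δ
  incExcᵉ≡ = begin
    toℚ (incExc xm x₁ x₂ x₃ e)                  ≡⟨ cong toℚ (incExc-factorisation D e) ⟩
    toℚ (pw g e ℤ.* cofactorProduct y₁ y₂ y₃ e) ≡⟨ cong (λ t → toℚ (pw g e ℤ.* t)) (ℤ∣._∣_.equality C∣Cᵉ) ⟩
    toℚ (pw g e ℤ.* (q ℤ.* C))                  ≡⟨ cong toℚ (signs (pw g e) q C) ⟩
    toℚ (ℤ.- (pw g e ℤ.* q) ℤ.* ℤ.- C)          ≡⟨ toℚ-homo-* (ℤ.- (pw g e ℤ.* q)) (ℤ.- C) ⟩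
    toℚ (ℤ.- (pw g e ℤ.* q)) ℚ.* toℚ (ℤ.- C)    ≡⟨ cong (toℚ (ℤ.- (pw g e ℤ.* q)) ℚ.*_) R*Δ≡ ⟨
    toℚ (ℤ.- (pw g e ℤ.* q)) ℚ.* (R ℚ.* Δ)      ≡⟨ ℚP.*-assoc (toℚ (ℤ.- (pw g e ℤ.* q))) R Δ ⟨
    toℚ (ℤ.- (pw g e ℤ.* q)) ℚ.* R ℚ.* Δ        ≡⟨ cong (ℚ._* Δ) (toℚ-homo-* (ℤ.- (pw g e ℤ.* q)) (pw r a)) ⟨
    toℚ (ℤ.- (pw g e ℤ.* q) ℤ.* pw r a) ℚ.* Δ   ∎

lcm-of-GTDs : ∀ {S xm x x′} → SatisfiesG S → xm ∈ S → IsGTD S x xm → IsGTD S x′ xm → x ≢ x′ → lcm x x′ ≡ xm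
lcm-of-GTDs {xm = xm} satG xm∈S t t′ x≢x′ with satG xm xm∈S
... | inj₁ atMostOne = ⊥-elim (x≢x′ (atMostOne _ _ t t′))
... | inj₂ condG     = proj₁ (condG _ _ t t′ x≢x′)

-- opened only here: its _*_ would clash with the ring operations of InclusionExclusion
open import Data.Rational using (ℚ; _*_)

lemma2p14 : (a b : ℕ) → 0 < a → 0 < b → a ∣ b →
    (S : List ℕ) → AllPositive S → GcdClosed S → SatisfiesG S →
    (xm x₁ x₂ x₃ : ℕ) → xm ∈ S → GTDsAre S xm x₁ x₂ x₃ →
    (incExc xm x₁ x₂ x₃ a ℤD.∣ incExc xm x₁ x₂ x₃ b)
    × (∀ xt → xt ∈ S → xt ∣ xm →
        let D = toℚ (+ (xt ^ a)) * incExcInv xm x₁ x₂ x₃ a in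
        D ≢ Data.Rational.0ℚ
        × ∃ λ (k : ℤ) → toℚ (incExc xm x₁ x₂ x₃ (b ∸ a)) ≡ toℚ k * D)
lemma2p14 a b 0<a 0<b a∣b S positive _ satG xm x₁ x₂ x₃ xm∈S (x₁≢x₂ , x₁≢x₃ , x₂≢x₃ , _ , t₁ , t₂ , t₃) =
  incExc-∣ D a≤b a∣b ,
  λ xt _ xt∣xm → incExcInv-quotient D (cofactor>1 t₁) (cofactor>1 t₂) (cofactor>1 t₃) 0<a a∣b∸a xt∣xm
  where
  instance
    xm≢0 : NonZero xm
    xm≢0 = ℕ.>-nonZero (All.lookup positive xm∈S)
  divisor : ∀ {x} → IsGTD S x xm → x ∣ xm
  divisor (_ , _ , _ , x∣xm , _) = x∣xm
  cofactor>1 : ∀ {x} (t : IsGTD S x xm) → 1 < ℕ∣.quotient (divisor t)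
  cofactor>1 (_ , _ , x<xm , x∣xm , _) = ℕ∣.quotient>1 x∣xm x<xm
  D = decompose (ℕ∣.m∣n⇒n≡quotient*m (divisor t₁)) (ℕ∣.m∣n⇒n≡quotient*m (divisor t₂))
                (ℕ∣.m∣n⇒n≡quotient*m (divisor t₃))
                (lcm-of-GTDs satG xm∈S t₁ t₂ x₁≢x₂) (lcm-of-GTDs satG xm∈S t₁ t₃ x₁≢x₃) (lcm-of-GTDs satG xm∈S t₂ t₃ x₂≢x₃)
  a≤b = ℕ∣.∣⇒≤ {{ℕ.>-nonZero 0<b}} a∣b
  a∣b∸a = ℕ∣.∣m+n∣m⇒∣n (subst (a ∣_) (sym (ℕP.m+[n∸m]≡n a≤b)) a∣b) ℕ∣.∣-refl
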